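{- For every connected graph $G$, $w(G)\ge 1$.
   Context: A pebbling distribution assigns to each vertex $v$ a non-negative integer $D(v)$ of pebbles; a rooted distribution fixes a root $r$. A pebbling step $[a,b]$, for adjacent $a,b$, removes two pebbles from $a$ and adds one to $b$. A rooted distribution is $r$-solvable if some sequence of pebbling steps ends with at least one pebble on $r$; it is $r$-critical if it is $r$-solvable but removing any single pebble makes it not $r$-solvable. $c_r(G)$ is the largest size (number of pebbles) of an $r$-critical rooted distribution on $G$ over all roots $r$; an $r$-ceiling distribution is an $r$-critical rooted distribution (for any root $r$) with exactly $c_r(G)$ pebbles. The weight of a rooted distribution is $w(D)=\sum_v D(v)/2^{d(v,r)}$ ($d$ = graph distance), and the weight $w(G)$ of $G$ is the largest weight of an $r$-ceiling distribution on $G$. -}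

module Defs where

open import Data.Nat as ℕ using (ℕ; zero; suc; _≥_; _≤_; _∸_; _+_)
open import Data.Fin using (Fin)
open import Data.Fin.Properties using (_≟_)
open import Data.List using (List; map)
open import Data.Nat.ListAction using (sum)
open import Data.List as L using (foldr)
open import Data.Integer using (+_)
open import Data.Rational as ℚ using (ℚ; ½; 1ℚ; 0ℚ)
open import Data.Product using (Σ; ∃; ∃-syntax; _×_; _,_)
open import Data.Empty using (⊥)
open import Relation.Nullary using (¬_; yes; no; Dec)
open import Relation.Binary using (Rel; Symmetric; Irreflexive; Decidable)
open import Relation.Binary.PropositionalEquality using (_≡_)
open import Relation.Binary.Construct.Closure.ReflexiveTransitive using (Star)
open import Data.List using (allFin) public

record Graph : Set₁ where
  field
    n      : ℕ
    Adj    : Fin n → Fin n → Set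
    sym    : ∀ {u v} → Adj u v → Adj v u
    irrefl : ∀ {u} → ¬ Adj u u
    adj?   : ∀ u v → Dec (Adj u v)
open Graph public

if⌊_⌋ : ∀ {P : Set} → Dec P → ℕ → ℕ → ℕ
if⌊ yes _ ⌋ t e = t
if⌊ no _ ⌋ t e = e

module _ (G : Graph) where

  V : Set
  V = Fin (n G)

  data Walk : V → V → ℕ → Set where
    here : ∀ {v} → Walk v v 0
    step : ∀ {u w v k} → Adj G u w → Walk w v k → Walk u v (suc k)

  Connected : Set
  Connected = ∀ (u v : V) → ∃[ k ] Walk u v k

  IsDistance : V → V → ℕ → Set
  IsDistance u v k = Walk u v k × (∀ m → Walk u v m → k ≤ m)

  Distribution : Set
  Distribution = V → ℕ

  size : Distribution → ℕ
  size D = sum (map D (allFin (n G)))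

  data PebStep : Distribution → Distribution → Set where
    peb : ∀ (D : Distribution) (a b : V) → Adj G a b → D a ≥ 2 →
          PebStep D (λ x → (if⌊ x ≟ a ⌋ (D x ∸ 2) (D x)) + (if⌊ x ≟ b ⌋ 1 0))

  Solvable : V → Distribution → Set
  Solvable r D = ∃[ D' ] (Star PebStep D D' × D' r ≥ 1)

  removeOne : Distribution → V → Distribution
  removeOne D v x with x ≟ v
  ... | yes _ = D x ∸ 1
  ... | no _  = D x

  Critical : V → Distribution → Set
  Critical r D = Solvable r D × (∀ v → D v ≥ 1 → ¬ Solvable r (removeOne D v))

  Ceiling : V → Distribution → Set
  Ceiling r D = Critical r D × (∀ r' D' → Critical r' D' → size D' ≤ size D)

  halfPow : ℕ → ℚ
  halfPow zero = 1ℚ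
  halfPow (suc k) = ½ ℚ.* halfPow k

  -- weight of D given the distance function d(·, r)
  weightWith : (V → ℕ) → Distribution → ℚ
  weightWith d D = foldr ℚ._+_ 0ℚ (map (λ v → ((+ D v) ℚ./ 1) ℚ.* halfPow (d v)) (allFin (n G)))

  WeightAtLeastOne : V → Distribution → Set
  WeightAtLeastOne r D =
    ∃[ d ] ((∀ v → IsDistance v r (d v)) × 1ℚ ℚ.≤ weightWith d D)

  GraphWeightAtLeastOne : Set
  GraphWeightAtLeastOne = ∃[ r ] ∃[ D ] (Ceiling r D × WeightAtLeastOne r D)

-- A ceiling distribution is critical, hence solvable, so it suffices that ceiling distributions
-- exist and that every r-solvable distribution has weight at least 1.
--
-- Weight: with d v = d(v,r) we have d a ≤ d b + 1 along every edge, so a pebbling step [a,b],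
-- which trades weight 2·2^-(d a) for 2^-(d b) ≤ 2·2^-(d a), never increases the weight, and a
-- solution ends with a pebble on r, which alone has weight 2^0 = 1.
--
-- Existence: 2^k pebbles on a vertex at distance k from r can be moved to r, so in an r-critical
-- distribution no vertex carries more than 2^L pebbles, L bounding all distances. Solvability is
-- decidable by recursion on the number of pebbles (each step loses one), so the critical
-- distributions over all roots are a decidable family of bounded vectors, nonempty because a
-- single pebble on r is r-critical; one of maximum size among them is a ceiling distribution.

module Submission where

open import Defs hiding (sym)
open import Algebra.Bundles using (CommutativeMonoid)
import Algebra.Properties.CommutativeMonoid.Sum as CommutativeMonoidSum
open import Data.Empty using (⊥-elim)
open import Data.Fin using (Fin; zero; suc; punchIn; fromℕ<)
open import Data.Fin.Properties using (_≟_; any?; all?; punchInᵢ≢i)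
import Data.Integer as ℤ
import Data.Integer.Properties as ℤP
open import Data.List using (List; [_]; map; foldr; tabulate; filter; upTo; cartesianProductWith)
open import Data.List.Membership.Propositional using (_∈_)
open import Data.List.Membership.Propositional.Properties using (∈-cartesianProductWith⁺; ∈-upTo⁺; ∈-filter⁺)
open import Data.List.Properties using (map-cong)
open import Data.List.Relation.Unary.All as All using ()
open import Data.List.Relation.Unary.All.Properties using (all-filter)
open import Data.List.Relation.Unary.Any using (here)
open import Data.Nat as ℕ using (ℕ; zero; suc; NonZero; _+_; _*_; _∸_; _^_; _≤_; _<_; z≤n; s≤s; _≤?_)
import Data.Nat.Properties as ℕP
import Data.Nat.ListAction as ListAction
open import Data.List.Extrema ℕP.≤-totalOrder using (argmax; argmax-all; f[xs]≤f[argmax])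
open import Data.Nat.Induction using (<-wellFounded)
open import Data.Product using (∃; ∃-syntax; _×_; _,_; proj₁; proj₂)
open import Data.Rational as ℚ using (ℚ; ½; 0ℚ; 1ℚ)
import Data.Rational.Properties as ℚP
open import Data.Nat.Coprimality using (1-coprimeTo) renaming (sym to Coprime-sym)
open import Data.Sum using (_⊎_; inj₁; inj₂)
open import Data.Vec.Functional using (Vector; []; _∷_)
open import Function using (_∘_)
open import Induction.WellFounded using (Acc; acc)
open import Relation.Binary.Construct.Closure.ReflexiveTransitive using (Star; ε; _◅_; _◅◅_)
open import Relation.Binary.PropositionalEquality
  using (_≡_; _≢_; _≗_; refl; sym; trans; cong; cong₂; subst; module ≡-Reasoning)
open import Relation.Nullary using (¬_; Dec; yes; no)
open import Relation.Nullary.Decidable using (map′; _×-dec_; _⊎-dec_; _→-dec_; ¬?)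
open import Relation.Unary using (Decidable)
import Relation.Binary.Reasoning.Setoid as SetoidReasoning

module ℕΣ = CommutativeMonoidSum ℕP.+-0-commutativeMonoid
module ℚΣ = CommutativeMonoidSum ℚP.+-0-commutativeMonoid

module _ {c ℓ} (M : CommutativeMonoid c ℓ) where
  open CommutativeMonoid M renaming (ε to 0#)
  open CommutativeMonoidSum M
  open SetoidReasoning setoid

  sum-single : ∀ {n} (f : Fin n → Carrier) a → (∀ x → x ≢ a → f x ≈ 0#) → sum f ≈ f a
  sum-single {suc n} f a off = begin
    sum f                     ≈⟨ sum-remove {i = a} f ⟩
    f a ∙ sum (f ∘ punchIn a) ≈⟨ ∙-congˡ (sum-cong-≋ (λ i → off _ (punchInᵢ≢i a i))) ⟩
    f a ∙ sum {n} (λ _ → 0#)  ≈⟨ ∙-congˡ (sum-replicate-zero n) ⟩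
    f a ∙ 0#                  ≈⟨ identityʳ (f a) ⟩
    f a                       ∎

f≤sum : ∀ {n} (f : Fin n → ℕ) i → f i ≤ ℕΣ.sum f
f≤sum f zero    = ℕP.m≤m+n _ _
f≤sum f (suc i) = ℕP.≤-trans (f≤sum (f ∘ suc) i) (ℕP.m≤n+m _ (f zero))

sum-nonNeg : ∀ {n} (f : Fin n → ℚ) → (∀ i → 0ℚ ℚ.≤ f i) → 0ℚ ℚ.≤ ℚΣ.sum f
sum-nonNeg {zero}  f _  = ℚP.≤-refl
sum-nonNeg {suc n} f 0≤f = ℚP.+-mono-≤ (0≤f zero) (sum-nonNeg (f ∘ suc) (0≤f ∘ suc))

foldr-map-tabulate : ∀ {n} {A : Set} (f : A → ℚ) (g : Fin n → A) →
                     foldr ℚ._+_ 0ℚ (map f (tabulate g)) ≡ ℚΣ.sum (f ∘ g)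
foldr-map-tabulate {zero}  f g = refl
foldr-map-tabulate {suc n} f g = cong (f (g zero) ℚ.+_) (foldr-map-tabulate f (g ∘ suc))

minimal-witness : {P : ℕ → Set} → (∀ k → Dec (P k)) → ∀ {k} → P k → ∃[ m ] (P m × ∀ j → P j → m ≤ j)
minimal-witness P? {zero} Pk = zero , Pk , λ _ _ → z≤n
minimal-witness P? {suc k} Pk with P? zero
... | yes P0 = zero , P0 , λ _ _ → z≤n
... | no ¬P0 with minimal-witness (P? ∘ suc) Pk
...   | m , Pm , least = suc m , Pm , λ { zero P0 → ⊥-elim (¬P0 P0) ; (suc j) Pj → s≤s (least j Pj) }

boundedVectors : ∀ m → ℕ → List (Vector ℕ m)
boundedVectors zero    B = [ [] ]
boundedVectors (suc m) B = cartesianProductWith _∷_ (upTo (suc B)) (boundedVectors m B)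

boundedVectors-complete : ∀ {m B} (f : Vector ℕ m) → (∀ i → f i ≤ B) →
                          ∃[ g ] (g ∈ boundedVectors m B × f ≗ g)
boundedVectors-complete {zero}  f _   = [] , here refl , λ ()
boundedVectors-complete {suc m} f f≤B with boundedVectors-complete (f ∘ suc) (f≤B ∘ suc)
... | g , g∈ , f∘suc≗g = f zero ∷ g , ∈-cartesianProductWith⁺ _∷_ (∈-upTo⁺ (s≤s (f≤B zero))) g∈ , f≗
  where
  f≗ : f ≗ (f zero ∷ g)
  f≗ zero    = refl
  f≗ (suc i) = f∘suc≗g i

module _ {m B : ℕ} {P : Vector ℕ m → Set} (P? : Decidable P) (P-resp : ∀ {f g} → f ≗ g → P f → P g)
         (P-bounded : ∀ {f} → P f → ∀ i → f i ≤ B)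
         (μ : Vector ℕ m → ℕ) (μ-resp : ∀ {f g} → f ≗ g → μ f ≡ μ g) where

  maximum-exists : ∀ {f₀} → P f₀ → ∃[ f ] (P f × ∀ g → P g → μ g ≤ μ f)
  maximum-exists {f₀} Pf₀ = f* , argmax-all μ Pf₀ (all-filter P? (boundedVectors m B)) , maximal
    where
    candidates : List (Vector ℕ m)
    candidates = filter P? (boundedVectors m B)
    f* : Vector ℕ m
    f* = argmax μ f₀ candidates
    maximal : ∀ g → P g → μ g ≤ μ f*
    maximal g Pg with boundedVectors-complete g (P-bounded Pg)
    ... | h , h∈ , g≗h = subst (_≤ μ f*) (sym (μ-resp g≗h))
                           (All.lookup (f[xs]≤f[argmax] f₀ candidates) (∈-filter⁺ P? h∈ (P-resp g≗h Pg)))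

ι : ℕ → ℚ
ι k = ℤ.+ k ℚ./ 1

ι-nonNeg : ∀ k → 0ℚ ℚ.≤ ι k
ι-nonNeg k = ℚP.nonNegative⁻¹ (ι k) {{ℚP.normalize-nonNeg k 1}}

*-nonNeg : ∀ {p q} → 0ℚ ℚ.≤ p → 0ℚ ℚ.≤ q → 0ℚ ℚ.≤ p ℚ.* q
*-nonNeg {p} {q} 0≤p 0≤q =
  ℚP.nonNegative⁻¹ (p ℚ.* q) {{ℚP.nonNeg*nonNeg⇒nonNeg p {{ℚ.nonNegative 0≤p}} q {{ℚ.nonNegative 0≤q}}}}

ι-canonical : ∀ k → ι k ≡ ℚ.mkℚ (ℤ.+ k) 0 (Coprime-sym (1-coprimeTo k))
ι-canonical k = ℚP.normalize-coprime (Coprime-sym (1-coprimeTo k))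

-- ℚ addition reduces on canonical representatives, so the sum is computed after exposing them.
ι-+ : ∀ m n → ι (m + n) ≡ ι m ℚ.+ ι n
ι-+ m n = sym (begin
  ι m ℚ.+ ι n                                 ≡⟨ cong₂ ℚ._+_ (ι-canonical m) (ι-canonical n) ⟩
  (ℤ.+ m ℤ.* ℤ.+ 1 ℤ.+ ℤ.+ n ℤ.* ℤ.+ 1) ℚ./ 1 ≡⟨ cong (ℚ._/ 1) (cong₂ ℤ._+_ (ℤP.*-identityʳ (ℤ.+ m)) (ℤP.*-identityʳ (ℤ.+ n))) ⟩
  ι (m + n)                                   ∎)
  where open ≡-Reasoning

if-≟-refl : ∀ {n} (a : Fin n) {t e} → if⌊ a ≟ a ⌋ t e ≡ t
if-≟-refl a with a ≟ a
... | yes _   = refl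
... | no a≢a = ⊥-elim (a≢a refl)

if-≟-≢ : ∀ {n} {x a : Fin n} {t e} → x ≢ a → if⌊ x ≟ a ⌋ t e ≡ e
if-≟-≢ {x = x} {a} x≢a with x ≟ a
... | yes x≡a = ⊥-elim (x≢a x≡a)
... | no _    = refl

δ : ∀ {n} → Fin n → Vector ℕ n
δ a x = if⌊ x ≟ a ⌋ 1 0

δ-sum : ∀ {n} (a : Fin n) → ℕΣ.sum (δ a) ≡ 1
δ-sum a = trans (sum-single ℕP.+-0-commutativeMonoid (δ a) a (λ _ → if-≟-≢)) (if-≟-refl a)

δ-positive : ∀ {n} {a x : Fin n} → 1 ≤ δ a x → x ≡ a
δ-positive {a = a} {x} = positive (x ≟ a)
  where
  positive : (d : Dec (x ≡ a)) → 1 ≤ if⌊ d ⌋ 1 0 → x ≡ a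
  positive (yes x≡a) _  = x≡a
  positive (no _)    ()

dropTwo : ∀ {n} → Vector ℕ n → Fin n → Vector ℕ n
dropTwo D a x = if⌊ x ≟ a ⌋ (D x ∸ 2) (D x)

dropTwo-+δ : ∀ {n} (D : Vector ℕ n) {a} → 2 ≤ D a → ∀ x → dropTwo D a x + (δ a x + δ a x) ≡ D x
dropTwo-+δ D {a} 2≤Da x = restore (x ≟ a)
  where
  restore : (d : Dec (x ≡ a)) → if⌊ d ⌋ (D x ∸ 2) (D x) + (if⌊ d ⌋ 1 0 + if⌊ d ⌋ 1 0) ≡ D x
  restore (yes refl) = ℕP.m∸n+n≡m 2≤Da
  restore (no _)     = ℕP.+-identityʳ (D x)

pebble : ∀ {n} → Vector ℕ n → Fin n → Fin n → Vector ℕ n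
pebble D a b x = dropTwo D a x + δ b x

pebble-source : ∀ {n} (D : Vector ℕ n) {a b} → a ≢ b → pebble D a b a ≡ D a ∸ 2
pebble-source D {a} a≢b = trans (cong₂ _+_ (if-≟-refl a) (if-≟-≢ a≢b)) (ℕP.+-identityʳ _)

pebble-target : ∀ {n} (D : Vector ℕ n) {a b} → a ≢ b → pebble D a b b ≡ D b + 1
pebble-target D {b = b} a≢b = cong₂ _+_ (if-≟-≢ (a≢b ∘ sym)) (if-≟-refl b)

pebble-resp : ∀ {n} {D E : Vector ℕ n} a b → D ≗ E → pebble D a b ≗ pebble E a b
pebble-resp a b D≗E x = cong (λ k → if⌊ x ≟ a ⌋ (k ∸ 2) k + δ b x) (D≗E x)

dropTwo-size : ∀ {n} (D : Vector ℕ n) {a} → 2 ≤ D a → ℕΣ.sum (dropTwo D a) + 2 ≡ ℕΣ.sum D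
dropTwo-size {n} D {a} 2≤Da = begin
  ℕΣ.sum (dropTwo D a) + 2                                 ≡⟨ cong (ℕΣ.sum (dropTwo D a) +_) (sym (cong₂ _+_ (δ-sum a) (δ-sum a))) ⟩
  ℕΣ.sum (dropTwo D a) + (ℕΣ.sum (δ a) + ℕΣ.sum (δ a))     ≡⟨ cong (ℕΣ.sum (dropTwo D a) +_) (sym (ℕΣ.∑-distrib-+ (δ a) (δ a))) ⟩
  ℕΣ.sum (dropTwo D a) + ℕΣ.sum {n} (λ x → δ a x + δ a x)  ≡⟨ sym (ℕΣ.∑-distrib-+ (dropTwo D a) _) ⟩
  ℕΣ.sum {n} (λ x → dropTwo D a x + (δ a x + δ a x))      ≡⟨ ℕΣ.sum-cong-≗ (dropTwo-+δ D 2≤Da) ⟩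
  ℕΣ.sum D                                                 ∎
  where open ≡-Reasoning

pebble-size-< : ∀ {n} (D : Vector ℕ n) {a} b → 2 ≤ D a → ℕΣ.sum (pebble D a b) < ℕΣ.sum D
pebble-size-< D {a} b 2≤Da = begin-strict
  ℕΣ.sum (pebble D a b)               ≡⟨ ℕΣ.∑-distrib-+ (dropTwo D a) (δ b) ⟩
  ℕΣ.sum (dropTwo D a) + ℕΣ.sum (δ b) ≡⟨ cong (ℕΣ.sum (dropTwo D a) +_) (δ-sum b) ⟩
  ℕΣ.sum (dropTwo D a) + 1            <⟨ ℕP.+-monoʳ-< (ℕΣ.sum (dropTwo D a)) (ℕP.n<1+n 1) ⟩
  ℕΣ.sum (dropTwo D a) + 2            ≡⟨ dropTwo-size D 2≤Da ⟩
  ℕΣ.sum D                            ∎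
  where open ℕP.≤-Reasoning

module _ (G : Graph) where

  Reach : Distribution G → Distribution G → Set
  Reach = Star (PebStep G)

  adj⇒≢ : ∀ {a b} → Adj G a b → a ≢ b
  adj⇒≢ adj refl = irrefl G adj

  reach-resp : ∀ {D D' E} → D ≗ E → Reach D D' → ∃[ E' ] (Reach E E' × D' ≗ E')
  reach-resp D≗E ε = _ , ε , D≗E
  reach-resp {E = E} D≗E (peb D a b adj 2≤Da ◅ rest) with reach-resp (pebble-resp a b D≗E) rest
  ... | E' , E↠E' , D'≗E' = E' , peb E a b adj (subst (2 ≤_) (D≗E a) 2≤Da) ◅ E↠E' , D'≗E'

  solvable-resp : ∀ {r D E} → D ≗ E → Solvable G r D → Solvable G r E
  solvable-resp {r} D≗E (D' , D↠D' , 1≤D'r) with reach-resp D≗E D↠D'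
  ... | E' , E↠E' , D'≗E' = E' , E↠E' , subst (1 ≤_) (D'≗E' r) 1≤D'r

  solvable-◅◅ : ∀ {r D E} → Reach D E → Solvable G r E → Solvable G r D
  solvable-◅◅ D↠E (F , E↠F , 1≤Fr) = F , D↠E ◅◅ E↠F , 1≤Fr

  SolvableByStep : V G → Distribution G → Set
  SolvableByStep r D = ∃[ a ] ∃[ b ] (Adj G a b × 2 ≤ D a × Solvable G r (pebble D a b))

  solvable-unfold : ∀ {r D} → Solvable G r D → 1 ≤ D r ⊎ SolvableByStep r D
  solvable-unfold (_ , ε , 1≤Dr)                         = inj₁ 1≤Dr
  solvable-unfold (F , peb _ a b adj 2≤Da ◅ rest , 1≤Fr) = inj₂ (a , b , adj , 2≤Da , F , rest , 1≤Fr)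

  solvable-fold : ∀ {r D} → 1 ≤ D r ⊎ SolvableByStep r D → Solvable G r D
  solvable-fold {D = D} (inj₁ 1≤Dr)                                   = D , ε , 1≤Dr
  solvable-fold {D = D} (inj₂ (a , b , adj , 2≤Da , F , rest , 1≤Fr)) = F , peb D a b adj 2≤Da ◅ rest , 1≤Fr

  solvable? : ∀ r D → Dec (Solvable G r D)
  solvable? r D = decide D (<-wellFounded (ℕΣ.sum D))
    where
    decide : ∀ D → Acc _<_ (ℕΣ.sum D) → Dec (Solvable G r D)
    decide D (acc rec) = map′ solvable-fold solvable-unfold (1 ≤? D r ⊎-dec any? λ a → any? λ b → step? a b)
      where
      step? : ∀ a b → Dec (Adj G a b × 2 ≤ D a × Solvable G r (pebble D a b))
      step? a b with adj? G a b | 2 ≤? D a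
      ... | no ¬adj | _        = no (¬adj ∘ proj₁)
      ... | yes _   | no ¬2≤Da = no (¬2≤Da ∘ proj₁ ∘ proj₂)
      ... | yes adj | yes 2≤Da =
        map′ (λ s → adj , 2≤Da , s) (proj₂ ∘ proj₂) (decide (pebble D a b) (rec (pebble-size-< D b 2≤Da)))

  empty-unsolvable : ∀ {r D} → (∀ x → D x ≡ 0) → ¬ Solvable G r D
  empty-unsolvable {r} D≗0 s with solvable-unfold s
  ... | inj₁ 1≤Dr                   = ℕP.<⇒≱ 1≤Dr (ℕP.≤-reflexive (D≗0 r))
  ... | inj₂ (a , _ , _ , 2≤Da , _) = ℕP.<⇒≱ 2≤Da (ℕP.≤-trans (ℕP.≤-reflexive (D≗0 a)) z≤n)

  removeOne-+δ : ∀ D {v} → 1 ≤ D v → ∀ x → removeOne G D v x + δ v x ≡ D x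
  removeOne-+δ D {v} 1≤Dv x with x ≟ v
  ... | yes refl = ℕP.m∸n+n≡m 1≤Dv
  ... | no _     = ℕP.+-identityʳ (D x)

  removeOne-self : ∀ D v → removeOne G D v v ≡ D v ∸ 1
  removeOne-self D v with v ≟ v
  ... | yes _   = refl
  ... | no v≢v = ⊥-elim (v≢v refl)

  removeOne-resp : ∀ {D E} v → D ≗ E → removeOne G D v ≗ removeOne G E v
  removeOne-resp v D≗E x with x ≟ v
  ... | yes _ = cong (_∸ 1) (D≗E x)
  ... | no _  = D≗E x

  critical? : ∀ r D → Dec (Critical G r D)
  critical? r D = solvable? r D ×-dec all? λ v → (1 ≤? D v) →-dec ¬? (solvable? r (removeOne G D v))

  critical-resp : ∀ {r D E} → D ≗ E → Critical G r D → Critical G r E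
  critical-resp D≗E (solvable , minimal) =
    solvable-resp D≗E solvable ,
    λ v 1≤Ev s → minimal v (subst (1 ≤_) (sym (D≗E v)) 1≤Ev) (solvable-resp (λ x → sym (removeOne-resp v D≗E x)) s)

  δ-critical : ∀ r → Critical G r (δ r)
  δ-critical r = (δ r , ε , ℕP.≤-reflexive (sym (if-≟-refl r))) , emptied
    where
    emptied : ∀ v → 1 ≤ δ r v → ¬ Solvable G r (removeOne G (δ r) v)
    emptied v 1≤δrv with δ-positive 1≤δrv
    ... | refl = empty-unsolvable λ x → ℕP.+-cancelʳ-≡ (δ v x) _ 0 (removeOne-+δ (δ v) 1≤δrv x)

  walk? : ∀ k u v → Dec (Walk G u v k)
  walk? zero u v with u ≟ v
  ... | yes refl = yes here
  ... | no u≢v  = no λ { here → u≢v refl }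
  walk? (suc k) u v =
    map′ (λ (_ , adj , walk) → step adj walk) (λ { (step adj walk) → _ , adj , walk })
         (any? λ w → adj? G u w ×-dec walk? k w v)

  transfer : ∀ {v w} → Adj G v w → ∀ j D → 2 * j ≤ D v → ∃[ E ] (Reach D E × D w + j ≤ E w)
  transfer adj zero D _ = D , ε , ℕP.≤-reflexive (ℕP.+-identityʳ _)
  transfer {v} {w} adj (suc j) D 2[1+j]≤Dv = extend (transfer adj j (pebble D v w) 2j≤D₁v)
    where
    v≢w : v ≢ w
    v≢w = adj⇒≢ adj
    2+2j≤Dv : 2 + 2 * j ≤ D v
    2+2j≤Dv = subst (_≤ D v) (ℕP.*-suc 2 j) 2[1+j]≤Dv
    2j≤D₁v : 2 * j ≤ pebble D v w v
    2j≤D₁v = subst (2 * j ≤_) (sym (pebble-source D v≢w)) (ℕP.∸-monoˡ-≤ 2 2+2j≤Dv)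
    extend : ∃[ E ] (Reach (pebble D v w) E × pebble D v w w + j ≤ E w) → ∃[ E ] (Reach D E × D w + suc j ≤ E w)
    extend (E , D₁↠E , D₁w+j≤Ew) =
      E , peb D v w adj (ℕP.≤-trans (ℕP.m≤m+n 2 _) 2+2j≤Dv) ◅ D₁↠E ,
      subst (_≤ E w) (trans (cong (_+ j) (pebble-target D v≢w)) (ℕP.+-assoc (D w) 1 j)) D₁w+j≤Ew

  walk-solvable : ∀ {v r k D} → Walk G v r k → 2 ^ k ≤ D v → Solvable G r D
  walk-solvable {D = D} here 1≤Dr = D , ε , 1≤Dr
  walk-solvable {k = suc k} {D} (step adj walk) 2^[1+k]≤Dv with transfer adj (2 ^ k) D 2^[1+k]≤Dv
  ... | E , D↠E , Dw+2^k≤Ew = solvable-◅◅ D↠E (walk-solvable walk (ℕP.≤-trans (ℕP.m≤n+m _ _) Dw+2^k≤Ew))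

  halfPow-nonNeg : ∀ k → 0ℚ ℚ.≤ halfPow G k
  halfPow-nonNeg zero    = ℚP.nonNegative⁻¹ 1ℚ
  halfPow-nonNeg (suc k) = *-nonNeg (ℚP.nonNegative⁻¹ ½) (halfPow-nonNeg k)

  halfPow-halves : ∀ k → halfPow G (suc k) ℚ.+ halfPow G (suc k) ≡ halfPow G k
  halfPow-halves k = trans (sym (ℚP.*-distribʳ-+ (halfPow G k) ½ ½)) (ℚP.*-identityˡ (halfPow G k))

  halfPow-suc-≤ : ∀ k → halfPow G (suc k) ℚ.≤ halfPow G k
  halfPow-suc-≤ k = begin
    halfPow G (suc k)                         ≡⟨ sym (ℚP.+-identityʳ _) ⟩
    halfPow G (suc k) ℚ.+ 0ℚ                  ≤⟨ ℚP.+-monoʳ-≤ (halfPow G (suc k)) (halfPow-nonNeg (suc k)) ⟩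
    halfPow G (suc k) ℚ.+ halfPow G (suc k)   ≡⟨ halfPow-halves k ⟩
    halfPow G k                               ∎
    where open ℚP.≤-Reasoning

  halfPow-antitone : ∀ {k k'} → k ≤ k' → halfPow G k' ℚ.≤ halfPow G k
  halfPow-antitone = antitone ∘ ℕP.≤⇒≤′
    where
    antitone : ∀ {k k'} → k ℕ.≤′ k' → halfPow G k' ℚ.≤ halfPow G k
    antitone ℕ.≤′-refl           = ℚP.≤-refl
    antitone (ℕ.≤′-step {n} k≤′n) = ℚP.≤-trans (halfPow-suc-≤ n) (antitone k≤′n)

  module Weight (d : V G → ℕ) where

    term : Distribution G → V G → ℚ
    term D v = ι (D v) ℚ.* halfPow G (d v)

    weight : Distribution G → ℚ
    weight D = ℚΣ.sum (term D)

    weightWith≡weight : ∀ D → weightWith G d D ≡ weight D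
    weightWith≡weight D = foldr-map-tabulate (term D) (λ v → v)

    weight-resp : ∀ {D E} → D ≗ E → weight D ≡ weight E
    weight-resp D≗E = ℚΣ.sum-cong-≗ λ x → cong (λ k → ι k ℚ.* halfPow G (d x)) (D≗E x)

    weight-+ : ∀ D E → weight (λ x → D x + E x) ≡ weight D ℚ.+ weight E
    weight-+ D E = trans (ℚΣ.sum-cong-≗ distrib) (ℚΣ.∑-distrib-+ (term D) (term E))
      where
      distrib : ∀ x → term (λ y → D y + E y) x ≡ term D x ℚ.+ term E x
      distrib x = trans (cong (ℚ._* halfPow G (d x)) (ι-+ (D x) (E x)))
                        (ℚP.*-distribʳ-+ (halfPow G (d x)) (ι (D x)) (ι (E x)))

    weight-δ : ∀ a → weight (δ a) ≡ halfPow G (d a)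
    weight-δ a = trans (sum-single ℚP.+-0-commutativeMonoid (term (δ a)) a vanishes)
                       (trans (cong (λ k → ι k ℚ.* halfPow G (d a)) (if-≟-refl a)) (ℚP.*-identityˡ _))
      where
      vanishes : ∀ x → x ≢ a → term (δ a) x ≡ 0ℚ
      vanishes x x≢a = trans (cong (λ k → ι k ℚ.* halfPow G (d x)) (if-≟-≢ x≢a))
                             (ℚP.*-zeroˡ (halfPow G (d x)))

    weight-nonNeg : ∀ D → 0ℚ ℚ.≤ weight D
    weight-nonNeg D = sum-nonNeg (term D) λ v → *-nonNeg (ι-nonNeg (D v)) (halfPow-nonNeg (d v))

    weight-pebble : ∀ D {a b} → d a ≤ suc (d b) → 2 ≤ D a → weight (pebble D a b) ℚ.≤ weight D
    weight-pebble D {a} {b} da≤1+db 2≤Da = begin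
      weight (pebble D a b)                          ≡⟨ weight-+ (dropTwo D a) (δ b) ⟩
      w₀ ℚ.+ weight (δ b)                            ≡⟨ cong (w₀ ℚ.+_) (weight-δ b) ⟩
      w₀ ℚ.+ halfPow G (d b)                         ≡⟨ cong (w₀ ℚ.+_) (sym (halfPow-halves (d b))) ⟩
      w₀ ℚ.+ (h[1+db] ℚ.+ h[1+db])                   ≤⟨ ℚP.+-monoʳ-≤ w₀ (ℚP.+-mono-≤ h[1+db]≤h[da] h[1+db]≤h[da]) ⟩
      w₀ ℚ.+ (halfPow G (d a) ℚ.+ halfPow G (d a))   ≡⟨ cong (w₀ ℚ.+_) (sym (cong₂ ℚ._+_ (weight-δ a) (weight-δ a))) ⟩
      w₀ ℚ.+ (weight (δ a) ℚ.+ weight (δ a))         ≡⟨ cong (w₀ ℚ.+_) (sym (weight-+ (δ a) (δ a))) ⟩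
      w₀ ℚ.+ weight (λ x → δ a x + δ a x)            ≡⟨ sym (weight-+ (dropTwo D a) _) ⟩
      weight (λ x → dropTwo D a x + (δ a x + δ a x)) ≡⟨ weight-resp (dropTwo-+δ D 2≤Da) ⟩
      weight D                                       ∎
      where
      open ℚP.≤-Reasoning
      w₀ : ℚ
      w₀ = weight (dropTwo D a)
      h[1+db] : ℚ
      h[1+db] = halfPow G (suc (d b))
      h[1+db]≤h[da] : h[1+db] ℚ.≤ halfPow G (d a)
      h[1+db]≤h[da] = halfPow-antitone da≤1+db

    weight-reach : (∀ {a b} → Adj G a b → d a ≤ suc (d b)) → ∀ {D E} → Reach D E → weight E ℚ.≤ weight D
    weight-reach d-adj ε                            = ℚP.≤-refl
    weight-reach d-adj (peb D a b adj 2≤Da ◅ D₁↠E) =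
      ℚP.≤-trans (weight-reach d-adj D₁↠E) (weight-pebble D (d-adj adj) 2≤Da)

    weight-root : ∀ {r D} → d r ≡ 0 → 1 ≤ D r → 1ℚ ℚ.≤ weight D
    weight-root {r} {D} dr≡0 1≤Dr = begin
      1ℚ                                       ≡⟨ sym (ℚP.+-identityˡ 1ℚ) ⟩
      0ℚ ℚ.+ 1ℚ                                ≤⟨ ℚP.+-monoˡ-≤ 1ℚ (weight-nonNeg (removeOne G D r)) ⟩
      weight (removeOne G D r) ℚ.+ 1ℚ          ≡⟨ cong (weight (removeOne G D r) ℚ.+_) (sym (trans (weight-δ r) (cong (halfPow G) dr≡0))) ⟩
      weight (removeOne G D r) ℚ.+ weight (δ r) ≡⟨ sym (weight-+ (removeOne G D r) (δ r)) ⟩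
      weight (λ x → removeOne G D r x + δ r x) ≡⟨ weight-resp (removeOne-+δ D 1≤Dr) ⟩
      weight D                                 ∎
      where open ℚP.≤-Reasoning

  module Distance (connected : Connected G) where

    shortest : ∀ u v → ∃[ k ] IsDistance G u v k
    shortest u v = minimal-witness (λ k → walk? k u v) (proj₂ (connected u v))

    dist : V G → V G → ℕ
    dist u v = proj₁ (shortest u v)

    dist-isDistance : ∀ u v → IsDistance G u v (dist u v)
    dist-isDistance u v = proj₂ (shortest u v)

    dist-adj : ∀ r {a b} → Adj G a b → dist a r ≤ suc (dist b r)
    dist-adj r {a} {b} adj = proj₂ (dist-isDistance a r) _ (step adj (proj₁ (dist-isDistance b r)))

    dist-self : ∀ r → dist r r ≡ 0
    dist-self r = ℕP.n≤0⇒n≡0 (proj₂ (dist-isDistance r r) 0 here)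

    -- Any common bound on the distances would do.
    distBound : ℕ
    distBound = ℕΣ.sum λ u → ℕΣ.sum (dist u)

    dist≤distBound : ∀ u v → dist u v ≤ distBound
    dist≤distBound u v = ℕP.≤-trans (f≤sum (dist u) v) (f≤sum (λ u → ℕΣ.sum (dist u)) u)

    solvable⇒weight≥1 : ∀ {r D} → Solvable G r D → 1ℚ ℚ.≤ Weight.weight (λ v → dist v r) D
    solvable⇒weight≥1 {r} (E , D↠E , 1≤Er) =
      ℚP.≤-trans (weight-root {D = E} (dist-self r) 1≤Er) (weight-reach (dist-adj r) D↠E)
      where open Weight (λ v → dist v r)

    critical-bounded : ∀ {r D} → Critical G r D → ∀ x → D x ≤ 2 ^ distBound
    critical-bounded {r} {D} (_ , minimal) x with 1 ≤? D x | D x ≤? 2 ^ distBound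
    ... | _        | yes Dx≤bound = Dx≤bound
    ... | no Dx≱1  | _          = ℕP.≤-trans (ℕP.≤-pred (ℕP.≰⇒> Dx≱1)) z≤n
    ... | yes 1≤Dx | no Dx≰bound  = ⊥-elim (minimal x 1≤Dx (walk-solvable (proj₁ (dist-isDistance x r)) enough))
      where
      enough : 2 ^ dist x r ≤ removeOne G D x x
      enough = ℕP.≤-trans (ℕP.^-monoʳ-≤ 2 (dist≤distBound x r))
                 (subst (2 ^ distBound ≤_) (sym (removeOne-self D x)) (ℕP.∸-monoˡ-≤ 1 (ℕP.≰⇒> Dx≰bound)))

    ceiling-exists : NonZero (n G) →
                     ∃[ D ] ((∃[ r ] Critical G r D) × ∀ r' D' → Critical G r' D' → size G D' ≤ size G D)
    ceiling-exists nonEmpty with maximum-exists (λ D → any? λ r → critical? r D)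
                                  (λ { D≗E (r , critical) → r , critical-resp D≗E critical })
                                  (critical-bounded ∘ proj₂)
                                  (size G) (λ D≗E → cong ListAction.sum (map-cong D≗E (allFin (n G))))
                                  (_ , δ-critical (fromℕ< (ℕ.>-nonZero⁻¹ (n G) {{nonEmpty}})))
    ... | D , critical , maximal = D , critical , λ r' D' c' → maximal D' (r' , c')

corollary13 : (G : Graph) → NonZero (n G) → Connected G → GraphWeightAtLeastOne G
corollary13 G nonEmpty connected =
  let D , (r , critical) , maximal = ceiling-exists nonEmpty in
  r , D , (critical , maximal) , (λ v → dist v r) , (λ v → dist-isDistance v r) ,
  subst (1ℚ ℚ.≤_) (sym (Weight.weightWith≡weight G (λ v → dist v r) D)) (solvable⇒weight≥1 (proj₁ critical))
  where open Distance G connected
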